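{- Let $T$ be a tree of order $n \ge 3$ with maximum degree $\Delta$. Then \[ F_t(T) \le \left( \frac{\Delta}{\Delta + 1} \right) n, \] with equality if and only if $T \cong K_{1,\Delta}$.
   Context: All graphs are finite, simple and undirected. Forcing process: given a graph $G$ and an initial set $S \subseteq V(G)$ of colored vertices (all others non-colored), at each step a colored vertex that has exactly one non-colored neighbor forces (colors) that neighbor. $S$ is a forcing set if iterating this process eventually colors all of $V(G)$. A total forcing set (TF-set) of a graph without isolated vertices is a forcing set $S$ such that the induced subgraph $G[S]$ has no isolated vertex. The total forcing number $F_t(G)$ is the minimum cardinality of a TF-set of $G$. -}

module Defs where

open import Data.Nat using (ℕ; zero; suc; _+_; _*_; _≤_; _⊔_)
open import Data.Bool using (Bool; true; false; T; _xor_)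
open import Data.Fin using (Fin; zero; suc)
open import Data.Fin.Subset using (Subset; _∈_; ∣_∣)
open import Data.List using (List; []; _∷_; _∷ʳ_; length; filterᵇ; foldr)
open import Data.List.Relation.Unary.Unique.Propositional using (Unique)
open import Data.List.Base using ()
open import Data.Product using (Σ; _×_; ∃; _,_)
open import Data.Unit using (⊤)
open import Data.Empty using (⊥)
open import Relation.Nullary using (¬_)
open import Relation.Binary.PropositionalEquality using (_≡_; _≢_)
open import Function.Bundles using (_↔_; Inverse)
open import Data.List using (allFin) public

record Graph (n : ℕ) : Set where
  field
    adj    : Fin n → Fin n → Bool
    sym    : ∀ u v → adj u v ≡ adj v u
    irrefl : ∀ v → adj v v ≡ false
open Graph public

Adj : ∀ {n} → Graph n → Fin n → Fin n → Set
Adj G u v = T (adj G u v)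

data Walk {n} (G : Graph n) : Fin n → Fin n → Set where
  here : ∀ {u} → Walk G u u
  step : ∀ {u w v} → Adj G u w → Walk G w v → Walk G u v

Connected : ∀ {n} → Graph n → Set
Connected G = ∀ u v → Walk G u v

Consecutive : ∀ {n} → Graph n → List (Fin n) → Set
Consecutive G []            = ⊤
Consecutive G (x ∷ [])      = ⊤
Consecutive G (x ∷ y ∷ xs)  = Adj G x y × Consecutive G (y ∷ xs)

Cycle : ∀ {n} → Graph n → Set
Cycle {n} G = Σ (Fin n) λ v → Σ (List (Fin n)) λ xs →
  (2 ≤ length xs) × Unique (v ∷ xs) × Consecutive G ((v ∷ xs) ∷ʳ v)

Acyclic : ∀ {n} → Graph n → Set
Acyclic G = ¬ Cycle G

IsTree : ∀ {n} → Graph n → Set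
IsTree G = Connected G × Acyclic G

degree : ∀ {n} → Graph n → Fin n → ℕ
degree G v = length (filterᵇ (adj G v) (allFin _))

maxDegree : ∀ {n} → Graph n → ℕ
maxDegree G = foldr (λ v m → degree G v ⊔ m) 0 (allFin _)

-- Forcing closure: the set of vertices eventually coloured starting from S.
data Colored {n} (G : Graph n) (S : Subset n) : Fin n → Set where
  initial : ∀ {v} → v ∈ S → Colored G S v
  forced  : ∀ {u v} → Colored G S u → Adj G u v →
            (∀ w → Adj G u w → w ≢ v → Colored G S w) → Colored G S v

IsForcingSet : ∀ {n} → Graph n → Subset n → Set
IsForcingSet G S = ∀ v → Colored G S v

NoIsolatedIn : ∀ {n} → Graph n → Subset n → Set
NoIsolatedIn {n} G S = ∀ v → v ∈ S → Σ (Fin n) λ u → u ∈ S × Adj G v u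

IsTFSet : ∀ {n} → Graph n → Subset n → Set
IsTFSet G S = IsForcingSet G S × NoIsolatedIn G S

IsTotalForcingNumber : ∀ {n} → Graph n → ℕ → Set
IsTotalForcingNumber {n} G k =
  (Σ (Subset n) λ S → IsTFSet G S × ∣ S ∣ ≡ k) ×
  (∀ S → IsTFSet G S → k ≤ ∣ S ∣)

isZero : ∀ {m} → Fin m → Bool
isZero zero    = true
isZero (suc _) = false

Star : (m : ℕ) → Graph (suc m)
Star m = record
  { adj    = λ i j → isZero i xor isZero j
  ; sym    = symX
  ; irrefl = irr }
  where
  symX : ∀ (i j : Fin (suc m)) → (isZero i xor isZero j) ≡ (isZero j xor isZero i)
  symX zero zero = _≡_.refl
  symX zero (suc j) = _≡_.refl
  symX (suc i) zero = _≡_.refl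
  symX (suc i) (suc j) = _≡_.refl
  irr : ∀ (i : Fin (suc m)) → (isZero i xor isZero i) ≡ false
  irr zero = _≡_.refl
  irr (suc i) = _≡_.refl

record _≅_ {n m} (G : Graph n) (H : Graph m) : Set where
  field
    bij      : Fin n ↔ Fin m
    preserve : ∀ u v → adj G u v ≡ adj H (Inverse.to bij u) (Inverse.to bij v)

module Submission where

-- Root the tree at a neighbour r of a leaf. Call a vertex thin if it has at most one child, and
-- good if at most one of its children is thin. Every vertex with children designates one child,
-- a thin one if possible, and a vertex is forced if it is a good designated child. The
-- complement S of the forced vertices is a total forcing set: going down the tree, a forced
-- vertex is the only uncoloured neighbour of its coloured parent, and goodness rules out
-- isolated vertices of S. Each vertex lies in the zone of some forced u (the parent, the
-- grandparent or a leaf sibling of u), which is contained in the closed neighbourhood of the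
-- parent of u; so n ≤ (Δ + 1)·#forced and F_t(T) ≤ ∣S∣ ≤ Δn/(Δ + 1). If a neighbour of r has a
-- child, it lies outside the zone of the forced child of r and the bound is strict; otherwise T
-- is a star. Conversely a total forcing set of K_{1,Δ} misses at most one vertex.

open import Defs hiding (sym)

open import Data.Bool using (true; false; if_then_else_; T; _xor_)
open import Data.Empty using (⊥-elim)
open import Data.Fin using (Fin; zero; suc)
import Data.Fin.Permutation as Perm
import Data.Fin.Permutation.Components as PC
open import Data.Fin.Properties as Fin using (_≟_; any?)
open import Data.Fin.Subset using (Subset; _∈_; _∉_; ∣_∣; inside; outside)
open import Data.Fin.Subset.Properties using (_∈?_)
open import Data.List as List using (List; []; _∷_; _∷ʳ_; length; filter)
open import Data.List.Extrema.Nat using (argmax; f[xs]≤f[argmax])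
open import Data.List.Membership.Propositional using () renaming (_∈_ to _∈ₗ_)
open import Data.List.Membership.Propositional.Properties using (∈-allFin)
open import Data.List.Properties using (length-++-≤ʳ)
open import Data.List.Relation.Unary.All as All using (All; []; _∷_)
import Data.List.Relation.Unary.All.Properties as All
open import Data.List.Relation.Unary.AllPairs using ([]; _∷_)
import Data.List.Relation.Unary.AllPairs.Properties as AllPairs
open import Data.List.Relation.Unary.Any using (here; there)
open import Data.List.Relation.Unary.Unique.Propositional using (Unique)
open import Data.Maybe using (Maybe; just; nothing)
open import Data.Maybe.Properties using (just-injective; ≡-dec)
import Data.Nat as ℕ
open import Data.Nat using (ℕ; zero; suc; pred; _⊔_; _+_; _*_; _≤_; _<_; z≤n; s≤s)
open import Data.Nat.Induction using (<-rec)
open import Data.Nat.Properties hiding (_≟_)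
open import Algebra.Properties.Semiring.Sum +-*-semiring
  using (sum; sum-cong-≗; sum-replicate-zero; ∑-distrib-+; ∑-comm; *-distribˡ-sum)
open import Data.Nat.Tactic.RingSolver using (solve-∀)
open import Data.Product using (Σ; ∃; _×_; _,_; proj₁; proj₂)
open import Data.Sum as Sum using (_⊎_; inj₁; inj₂)
open import Data.Vec using ([]; _∷_; tabulate)
open import Data.Vec.Properties using (lookup⇒[]=; []=⇒lookup; lookup∘tabulate)
open import Function using (_∘_; id)
open import Function.Bundles using (Inverse; _⇔_; mk⇔)
open import Level using (0ℓ)
open import Relation.Binary.Definitions using (tri<; tri≈; tri>)
open import Relation.Binary.PropositionalEquality
open import Relation.Nullary using (¬_; ¬?; yes; no; does; contradiction)
open import Relation.Nullary.Decidable using (dec-true; dec-false; decidable-stable; T?; _⊎-dec_; _×-dec_)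
open import Relation.Unary using (Pred; Decidable; _⊆_; _∩_; Empty)
open import Relation.Unary.Properties using (_∪?_; _∩?_; ∁?)

private
  variable
    n : ℕ

-- Finite sums and counting

sum-mono-≤ : {f g : Fin n → ℕ} → (∀ i → f i ≤ g i) → sum f ≤ sum g
sum-mono-≤ {zero}  f≤g = z≤n
sum-mono-≤ {suc n} f≤g = +-mono-≤ (f≤g zero) (sum-mono-≤ (f≤g ∘ suc))

sum-mono-< : {f g : Fin n → ℕ} → (∀ i → f i ≤ g i) → ∀ j → f j < g j → sum f < sum g
sum-mono-< f≤g zero    fj<gj = +-mono-<-≤ fj<gj (sum-mono-≤ (f≤g ∘ suc))
sum-mono-< f≤g (suc j) fj<gj = +-mono-≤-< (f≤g zero) (sum-mono-< (f≤g ∘ suc) j fj<gj)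

term≤sum : (f : Fin n → ℕ) (i : Fin n) → f i ≤ sum f
term≤sum f zero    = m≤m+n _ _
term≤sum f (suc i) = ≤-trans (term≤sum (f ∘ suc) i) (m≤n+m _ _)

sum-ones : sum {n} (λ _ → 1) ≡ n
sum-ones {zero}  = refl
sum-ones {suc n} = cong suc (sum-ones {n})

indicator : {P : Pred (Fin n) 0ℓ} → Decidable P → Fin n → ℕ
indicator P? i = if does (P? i) then 1 else 0

count : {P : Pred (Fin n) 0ℓ} → Decidable P → ℕ
count P? = sum (indicator P?)

module _ {P Q : Pred (Fin n) 0ℓ} (P? : Decidable P) (Q? : Decidable Q) where

  indicator-mono : P ⊆ Q → ∀ i → indicator P? i ≤ indicator Q? i
  indicator-mono P⊆Q i with P? i | Q? i
  ... | yes p | no ¬q = contradiction (P⊆Q p) ¬q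
  ... | yes _ | yes _ = ≤-refl
  ... | no _  | _     = z≤n

  count-mono : P ⊆ Q → count P? ≤ count Q?
  count-mono P⊆Q = sum-mono-≤ (indicator-mono P⊆Q)

  count-mono-< : P ⊆ Q → ∀ {j} → Q j → ¬ P j → count P? < count Q?
  count-mono-< P⊆Q {j} qj ¬pj = sum-mono-< (indicator-mono P⊆Q) j strict
    where
    strict : indicator P? j < indicator Q? j
    strict with P? j | Q? j
    ... | yes pj | _     = contradiction pj ¬pj
    ... | no _   | yes _ = s≤s z≤n
    ... | no _   | no ¬q = contradiction qj ¬q

  count-∪ : count (P? ∪? Q?) ≤ count P? + count Q?
  count-∪ = ≤-trans (sum-mono-≤ split) (≤-reflexive (∑-distrib-+ (indicator P?) (indicator Q?)))
    where
    split : ∀ i → indicator (P? ∪? Q?) i ≤ indicator P? i + indicator Q? i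
    split i with P? i | Q? i
    ... | yes _ | _     = s≤s z≤n
    ... | no _  | yes _ = ≤-refl
    ... | no _  | no _  = z≤n

module _ {P : Pred (Fin n) 0ℓ} (P? : Decidable P) where

  indicator-yes : ∀ {x} → P x → indicator P? x ≡ 1
  indicator-yes {x} px rewrite dec-true (P? x) px = refl

  indicator-no : ∀ {x} → ¬ P x → indicator P? x ≡ 0
  indicator-no {x} ¬px rewrite dec-false (P? x) ¬px = refl

  1≤count : ∀ {x} → P x → 1 ≤ count P?
  1≤count {x} px = ≤-trans (≤-reflexive (sym (indicator-yes px))) (term≤sum (indicator P?) x)

  count-empty : Empty P → count P? ≡ 0
  count-empty ∅ = trans (sum-cong-≗ (λ x → indicator-no (∅ x))) (sum-replicate-zero n)

  count-complement : count P? + count (∁? P?) ≡ n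
  count-complement = begin
    count P? + count (∁? P?)                         ≡⟨ ∑-distrib-+ (indicator P?) (indicator (∁? P?)) ⟨
    sum (λ x → indicator P? x + indicator (∁? P?) x) ≡⟨ sum-cong-≗ one ⟩
    sum {n} (λ _ → 1)                                ≡⟨ sum-ones ⟩
    n                                                ∎
    where
    open ≡-Reasoning
    one : ∀ x → indicator P? x + indicator (∁? P?) x ≡ 1
    one x with P? x
    ... | yes _ = refl
    ... | no _  = refl

count-cong : {P Q : Pred (Fin n) 0ℓ} (P? : Decidable P) (Q? : Decidable Q) →
  P ⊆ Q → Q ⊆ P → count P? ≡ count Q?
count-cong P? Q? P⊆Q Q⊆P = ≤-antisym (count-mono P? Q? P⊆Q) (count-mono Q? P? Q⊆P)

count-≡ : (a : Fin n) → count (_≟ a) ≡ 1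
count-≡ {suc n} zero    = cong suc (count-empty (λ (i : Fin n) → suc i ≟ zero) λ _ ())
count-≡ {suc n} (suc a) =
  trans (count-cong (λ i → suc i ≟ suc a) (_≟ a) Fin.suc-injective (cong suc)) (count-≡ a)

module _ {P : Pred (Fin n) 0ℓ} (P? : Decidable P) where

  count-witness : 1 ≤ count P? → ∃ P
  count-witness 1≤c with any? P?
  ... | yes ∃P = ∃P
  ... | no ¬∃P = contradiction (count-empty P? (λ x px → ¬∃P (x , px))) (m<n⇒n≢0 1≤c)

  count≤1 : (∀ {x y} → P x → P y → x ≡ y) → count P? ≤ 1
  count≤1 unique with any? P?
  ... | yes (a , pa) = ≤-trans (count-mono P? (_≟ a) (λ px → unique px pa)) (≤-reflexive (count-≡ a))
  ... | no none      = ≤-trans (≤-reflexive (count-empty P? λ x px → none (x , px))) z≤n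

  2≤count : ∀ {a b} → P a → P b → a ≢ b → 2 ≤ count P?
  2≤count {a} {b} pa pb a≢b =
    ≤-trans (s≤s (1≤count (P? ∩? (λ x → ¬? (x ≟ a))) (pb , a≢b ∘ sym)))
      (count-mono-< (P? ∩? (λ x → ¬? (x ≟ a))) P? proj₁ pa (λ (_ , a≢a) → a≢a refl))

  2≤count⇒other : ∀ a → 2 ≤ count P? → ∃ λ x → P x × x ≢ a
  2≤count⇒other a 2≤c with any? (P? ∩? (λ x → ¬? (x ≟ a)))
  ... | yes other = other
  ... | no ¬other = contradiction (count≤1 λ px py → trans (only-a px) (sym (only-a py))) (<⇒≱ 2≤c)
    where
    only-a : ∀ {x} → P x → x ≡ a
    only-a {x} px with x ≟ a
    ... | yes x≡a = x≡a
    ... | no x≢a  = contradiction (x , px , x≢a) ¬other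

module DoubleCounting {m} {U : Pred (Fin m) 0ℓ} (U? : Decidable U)
                      {Z : Fin m → Pred (Fin n) 0ℓ} (Z? : ∀ u → Decidable (Z u))
                      (covered : ∀ x → ∃ λ u → U u × Z u x) where

  private
    covers? : ∀ x → Decidable (λ u → U u × Z u x)
    covers? x u = U? u ×-dec Z? u x

    zoneSize : Fin m → ℕ
    zoneSize u = count (λ x → covers? x u)

    n≤∑zoneSize : n ≤ sum zoneSize
    n≤∑zoneSize = begin
      n                                         ≡⟨ sum-ones ⟨
      sum {n} (λ _ → 1)                         ≤⟨ sum-mono-≤ (λ x → 1≤count (covers? x) (proj₂ (covered x))) ⟩
      sum (λ x → sum (indicator (covers? x)))   ≡⟨ ∑-comm (λ x → indicator (covers? x)) ⟩
      sum zoneSize                              ∎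
      where open ≤-Reasoning

    zoneSize≤ : ∀ {c} → (∀ {u} → U u → count (Z? u) ≤ c) → ∀ u → zoneSize u ≤ c * indicator U? u
    zoneSize≤ {c} bounded u with U? u
    ... | yes uu = ≤-trans (count-mono (λ x → yes uu ×-dec Z? u x) (Z? u) proj₂)
                           (≤-trans (bounded uu) (≤-reflexive (sym (*-identityʳ c))))
    ... | no ¬uu = ≤-reflexive (trans (count-empty (λ x → no ¬uu ×-dec Z? u x) (λ _ → ¬uu ∘ proj₁))
                                      (sym (*-zeroʳ c)))

  covering-bound : ∀ {c} → (∀ {u} → U u → count (Z? u) ≤ c) → n ≤ c * count U?
  covering-bound {c} bounded = begin
    n                              ≤⟨ n≤∑zoneSize ⟩
    sum zoneSize                   ≤⟨ sum-mono-≤ (zoneSize≤ bounded) ⟩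
    sum (λ u → c * indicator U? u) ≡⟨ *-distribˡ-sum c (indicator U?) ⟨
    c * count U?                   ∎
    where open ≤-Reasoning

  covering-bound-< : ∀ {c u₀} → (∀ {u} → U u → count (Z? u) ≤ c) → U u₀ → count (Z? u₀) < c →
                     n < c * count U?
  covering-bound-< {c} {u₀} bounded uu₀ small = begin-strict
    n                              ≤⟨ n≤∑zoneSize ⟩
    sum zoneSize                   <⟨ sum-mono-< (zoneSize≤ bounded) u₀ u₀-below ⟩
    sum (λ u → c * indicator U? u) ≡⟨ *-distribˡ-sum c (indicator U?) ⟨
    c * count U?                   ∎
    where
    open ≤-Reasoning
    u₀-below : zoneSize u₀ < c * indicator U? u₀
    u₀-below = begin-strict
      zoneSize u₀               ≤⟨ count-mono (λ x → covers? x u₀) (Z? u₀) proj₂ ⟩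
      count (Z? u₀)             <⟨ small ⟩
      c                         ≡⟨ *-identityʳ c ⟨
      c * 1                     ≡⟨ cong (c *_) (indicator-yes U? uu₀) ⟨
      c * indicator U? u₀       ∎

length-filter-tabulate : ∀ {A : Set} {P : Pred A 0ℓ} (P? : Decidable P) (g : Fin n → A) →
  length (filter P? (List.tabulate g)) ≡ count (P? ∘ g)
length-filter-tabulate {zero}  P? g = refl
length-filter-tabulate {suc n} P? g with does (P? (g zero))
... | true  = cong suc (length-filter-tabulate P? (g ∘ suc))
... | false = length-filter-tabulate P? (g ∘ suc)

∣∣≡count : (p : Subset n) → ∣ p ∣ ≡ count (_∈? p)
∣∣≡count []            = refl
∣∣≡count (inside ∷ p)  = cong suc (∣∣≡count p)
∣∣≡count (outside ∷ p) = ∣∣≡count p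

module _ {P : Pred (Fin n) 0ℓ} (P? : Decidable P) where

  toSubset : Subset n
  toSubset = tabulate (does ∘ P?)

  ∈-toSubset⁺ : ∀ {x} → P x → x ∈ toSubset
  ∈-toSubset⁺ {x} px = lookup⇒[]= x toSubset (trans (lookup∘tabulate (does ∘ P?) x) (dec-true (P? x) px))

  ∈-toSubset⁻ : ∀ {x} → x ∈ toSubset → P x
  ∈-toSubset⁻ {x} x∈ with P? x | trans (sym (lookup∘tabulate (does ∘ P?) x)) ([]=⇒lookup x∈)
  ... | yes px | _  = px
  ... | no _   | ()

  ∣toSubset∣ : ∣ toSubset ∣ ≡ count P?
  ∣toSubset∣ = trans (∣∣≡count toSubset) (count-cong (_∈? toSubset) P? ∈-toSubset⁻ ∈-toSubset⁺)

-- Graphs and stars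

module _ {A : Set} (f : A → ℕ) where

  ≤-foldr-⊔ : ∀ {x xs} → x ∈ₗ xs → f x ≤ List.foldr (λ y m → f y ⊔ m) 0 xs
  ≤-foldr-⊔ (here refl) = m≤m⊔n _ _
  ≤-foldr-⊔ (there x∈)  = ≤-trans (≤-foldr-⊔ x∈) (m≤n⊔m _ _)

  foldr-⊔-lub : ∀ {b} → (∀ x → f x ≤ b) → ∀ xs → List.foldr (λ y m → f y ⊔ m) 0 xs ≤ b
  foldr-⊔-lub f≤b []       = z≤n
  foldr-⊔-lub f≤b (x ∷ xs) = ⊔-lub (f≤b x) (foldr-⊔-lub f≤b xs)

module _ {n} (G : Graph n) where

  Adj-sym : ∀ {u v} → Adj G u v → Adj G v u
  Adj-sym {u} {v} = subst T (Graph.sym G u v)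

  Adj⇒≢ : ∀ {u v} → Adj G u v → u ≢ v
  Adj⇒≢ {u} uv refl = subst T (irrefl G u) uv

  adj? : ∀ u → Decidable (Adj G u)
  adj? u v = T? (adj G u v)

  degree≡count : ∀ v → degree G v ≡ count (adj? v)
  degree≡count v = length-filter-tabulate (adj? v) id

  closedNbhd? : ∀ p → Decidable (λ x → x ≡ p ⊎ Adj G p x)
  closedNbhd? p = (_≟ p) ∪? adj? p

  count-closedNbhd : ∀ p → count (closedNbhd? p) ≤ suc (degree G p)
  count-closedNbhd p = begin
    count (closedNbhd? p)          ≤⟨ count-∪ (_≟ p) (adj? p) ⟩
    count (_≟ p) + count (adj? p)  ≡⟨ cong₂ _+_ (count-≡ p) (sym (degree≡count p)) ⟩
    suc (degree G p)               ∎
    where open ≤-Reasoning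

  degree<n : ∀ v → degree G v < n
  degree<n v = begin-strict
    degree G v                        ≡⟨ degree≡count v ⟩
    count (adj? v)                    ≤⟨ count-mono (adj? v) (∁? (_≟ v)) (λ vx x≡v → Adj⇒≢ vx (sym x≡v)) ⟩
    count (∁? (_≟ v))                 <⟨ n<1+n _ ⟩
    suc (count (∁? (_≟ v)))           ≡⟨ cong (_+ count (∁? (_≟ v))) (count-≡ v) ⟨
    count (_≟ v) + count (∁? (_≟ v))  ≡⟨ count-complement (_≟ v) ⟩
    n                                 ∎
    where open ≤-Reasoning

  degree≤maxDegree : ∀ v → degree G v ≤ maxDegree G
  degree≤maxDegree v = ≤-foldr-⊔ (degree G) (∈-allFin v)

  maxDegree-lub : ∀ {b} → (∀ v → degree G v ≤ b) → maxDegree G ≤ b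
  maxDegree-lub deg≤b = foldr-⊔-lub (degree G) deg≤b (allFin n)

  walk-closed : {P : Pred (Fin n) 0ℓ} → (∀ {u v} → Adj G u v → P u → P v) →
                ∀ {u v} → Walk G u v → P u → P v
  walk-closed closed here          pu = pu
  walk-closed closed (step uw wv) pu = walk-closed closed wv (closed uw pu)

  data Path : Fin n → Fin n → List (Fin n) → Set where
    [_]  : ∀ x → Path x x (x ∷ [])
    _∷_ : ∀ {x y z xs} → Adj G x y → Path y z xs → Path x z (x ∷ xs)

  Path-∷ʳ : ∀ {x y z xs} → Path x y xs → Adj G y z → Path x z (xs ∷ʳ z)
  Path-∷ʳ [ _ ]      yz = yz ∷ [ _ ]
  Path-∷ʳ (xw ∷ wy) yz = xw ∷ Path-∷ʳ wy yz

  Path⇒Consecutive : ∀ {x y xs} → Path x y xs → Consecutive G xs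
  Path⇒Consecutive [ _ ]              = _
  Path⇒Consecutive (xy ∷ [ _ ])       = xy , _
  Path⇒Consecutive (xy ∷ (yz ∷ path)) = xy , Path⇒Consecutive (yz ∷ path)

isZero≡does : ∀ {m} (x : Fin (suc m)) → isZero x ≡ does (x ≟ zero)
isZero≡does zero    = refl
isZero≡does (suc x) = refl

isZero∘transpose : ∀ {m} (r u : Fin (suc m)) → isZero (PC.transpose r zero u) ≡ does (u ≟ r)
isZero∘transpose r u with u ≟ r
... | yes _ = refl
... | no u≢r with u ≟ zero
...   | yes refl = trans (isZero≡does r) (dec-false (r ≟ zero) (u≢r ∘ sym))
...   | no u≢0   = trans (isZero≡does u) (dec-false (u ≟ zero) u≢0)

≅Star : ∀ {n m} (G : Graph n) (r : Fin n) → n ≡ suc m →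
        (∀ u v → adj G u v ≡ (does (u ≟ r) xor does (v ≟ r))) → G ≅ Star m
≅Star G r refl adj≡ = record
  { bij      = Perm.transpose r zero
  ; preserve = λ u v → trans (adj≡ u v) (sym (cong₂ _xor_ (isZero∘transpose r u) (isZero∘transpose r v)))
  }

module StarShaped {n} (G : Graph n) (r : Fin n) (spoke : ∀ {v} → v ≢ r → Adj G r v)
                  (independent : ∀ {v w} → Adj G r v → Adj G r w → ¬ Adj G v w) where

  adj-star : ∀ u v → adj G u v ≡ (does (u ≟ r) xor does (v ≟ r))
  adj-star u v with u ≟ r | v ≟ r
  ... | yes refl | yes refl = irrefl G u
  ... | yes refl | no v≢r   = dec-true (adj? G r v) (spoke v≢r)
  ... | no u≢r   | yes refl = dec-true (adj? G u r) (Adj-sym G (spoke u≢r))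
  ... | no u≢r   | no v≢r   = dec-false (adj? G u v) (independent (spoke u≢r) (spoke v≢r))

  n≡1+degree : n ≡ suc (degree G r)
  n≡1+degree = ≤-antisym n≤ (degree<n G r)
    where
    open ≤-Reasoning
    n≤ : n ≤ suc (degree G r)
    n≤ = begin
      n                                ≡⟨ count-complement (_≟ r) ⟨
      count (_≟ r) + count (∁? (_≟ r)) ≡⟨ cong (_+ count (∁? (_≟ r))) (count-≡ r) ⟩
      suc (count (∁? (_≟ r)))          ≤⟨ s≤s (count-mono (∁? (_≟ r)) (adj? G r) spoke) ⟩
      suc (count (adj? G r))           ≡⟨ cong suc (degree≡count G r) ⟨
      suc (degree G r)                 ∎

  maxDegree≡degree : maxDegree G ≡ degree G r
  maxDegree≡degree = ≤-antisym (maxDegree-lub G λ v → ≤-pred (subst (degree G v <_) n≡1+degree (degree<n G v)))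
                               (degree≤maxDegree G r)

  star-≅ : G ≅ Star (maxDegree G)
  star-≅ = ≅Star G r (trans n≡1+degree (cong suc (sym maxDegree≡degree))) adj-star

-- Trees rooted at a vertex

Least : Pred ℕ 0ℓ → Set
Least P = ∃ λ k → P k × (∀ {j} → j < k → ¬ P j)

least : {P : Pred ℕ 0ℓ} → Decidable P → ∀ {m} → P m → Least P
least {P} P? {m} = <-rec (λ m → P m → Least P) descend m
  where
  descend : ∀ m → (∀ {j} → j < m → P j → Least P) → P m → Least P
  descend m below pm with anyUpTo? P? m
  ... | yes (j , j<m , pj) = below j<m pj
  ... | no none            = m , pm , λ j<m pj → none (_ , j<m , pj)

module RootedTree {n} (G : Graph n) (connected : Connected G) (acyclic : Acyclic G) (r : Fin n) where

  Reach : ℕ → Pred (Fin n) 0ℓ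
  Reach zero    v = v ≡ r
  Reach (suc k) v = Reach k v ⊎ ∃ λ w → Reach k w × Adj G w v

  reach? : ∀ k → Decidable (Reach k)
  reach? zero    v = v ≟ r
  reach? (suc k) v = reach? k v ⊎-dec any? (λ w → reach? k w ×-dec adj? G w v)

  reach-walk : ∀ {k w v} → Reach k w → Walk G w v → ∃ λ j → Reach j v
  reach-walk {k} rw here        = k , rw
  reach-walk     rw (step wx xv) = reach-walk (inj₂ (_ , rw , wx)) xv

  -- Kept abstract, like parent and deepest-vertex: unfolding the well-founded recursion of least
  -- makes type checking blow up.
  abstract
    depth-least : ∀ v → Least (λ k → Reach k v)
    depth-least v = least (λ k → reach? k v) (proj₂ (reach-walk refl (connected r v)))

  depth : Fin n → ℕ
  depth v = proj₁ (depth-least v)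

  reach-depth : ∀ v → Reach (depth v) v
  reach-depth v = proj₁ (proj₂ (depth-least v))

  depth-minimal : ∀ {j v} → Reach j v → depth v ≤ j
  depth-minimal {j} {v} rj = ≮⇒≥ λ j<d → proj₂ (proj₂ (depth-least v)) j<d rj

  depth-adj : ∀ {w v} → Adj G w v → depth v ≤ suc (depth w)
  depth-adj {w} wv = depth-minimal (inj₂ (w , reach-depth w , wv))

  depth≡0⇒root : ∀ {v} → depth v ≡ 0 → v ≡ r
  depth≡0⇒root {v} d≡0 = subst (λ k → Reach k v) d≡0 (reach-depth v)

  depth-root : depth r ≡ 0
  depth-root = n≤0⇒n≡0 (depth-minimal refl)

  depth-nonroot : ∀ {v} → v ≢ r → ∃ λ k → depth v ≡ suc k
  depth-nonroot {v} v≢r with depth v in eq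
  ... | zero  = contradiction (depth≡0⇒root eq) v≢r
  ... | suc k = k , refl

  abstract
    parent : Fin n → Fin n
    parent v with any? (λ w → reach? (pred (depth v)) w ×-dec adj? G w v)
    ... | yes (w , _) = w
    ... | no _        = r

    parent-spec : ∀ {v} → v ≢ r → Reach (pred (depth v)) (parent v) × Adj G (parent v) v
    parent-spec {v} v≢r with any? (λ w → reach? (pred (depth v)) w ×-dec adj? G w v)
    ... | yes (w , spec) = spec
    ... | no none with depth-nonroot v≢r
    ...   | k , eq with subst (λ j → Reach j v) eq (reach-depth v)
    ...     | inj₁ rk = contradiction (subst (_≤ k) eq (depth-minimal rk)) (n≮n k)
    ...     | inj₂ (w , rw , wv) = contradiction (w , subst (λ j → Reach (pred j) w) (sym eq) rw , wv) none

  parent-adj : ∀ {v} → v ≢ r → Adj G (parent v) v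
  parent-adj v≢r = proj₂ (parent-spec v≢r)

  depth-parent : ∀ {v} → v ≢ r → depth v ≡ suc (depth (parent v))
  depth-parent {v} v≢r with depth-nonroot v≢r
  ... | k , eq = trans eq (cong suc (≤-antisym upper lower))
    where
    upper : k ≤ depth (parent v)
    upper = ≤-pred (subst (_≤ suc (depth (parent v))) eq (depth-adj (parent-adj v≢r)))
    lower : depth (parent v) ≤ k
    lower = depth-minimal (subst (λ j → Reach (pred j) (parent v)) eq (proj₁ (parent-spec v≢r)))

  parent-shallower : ∀ {v} → v ≢ r → depth (parent v) < depth v
  parent-shallower v≢r = ≤-reflexive (sym (depth-parent v≢r))

  nonroot : ∀ {v d} → depth v ≡ suc d → v ≢ r
  nonroot d≡ refl = 0≢1+n (trans (sym depth-root) d≡)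

  depth-parent′ : ∀ {v d} → depth v ≡ suc d → depth (parent v) ≡ d
  depth-parent′ d≡ = suc-injective (trans (sym (depth-parent (nonroot d≡))) d≡)

  shallower-≢ : ∀ {x y d} → depth x ≤ d → depth y ≡ suc d → y ≢ x
  shallower-≢ {d = d} x≤d y≡ refl = n≮n d (subst (_≤ d) y≡ x≤d)

  -- Two vertices of equal depth are joined through their ancestors by a path of shallower inner
  -- vertices; a common deeper neighbour or an edge between them would close it to a cycle.
  Bridge : ℕ → Fin n → Fin n → Set
  Bridge d p q = Σ (List (Fin n)) λ xs →
    Path G p q (p ∷ xs) × Unique (p ∷ xs) × All (λ x → depth x ≤ d) (p ∷ xs) × 2 ≤ length xs

  bridge : ∀ d {p q} → depth p ≡ d → depth q ≡ d → p ≢ q → Bridge d p q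
  bridge zero dp dq p≢q = contradiction (trans (depth≡0⇒root dp) (sym (depth≡0⇒root dq))) p≢q
  bridge (suc d) {p} {q} dp dq p≢q with parent p ≟ parent q
  ... | yes same = parent p ∷ q ∷ [] , path , distinct , bounded , ≤-refl
    where
    path : Path G p q (p ∷ parent p ∷ q ∷ [])
    path = Adj-sym G (parent-adj (nonroot dp))
         ∷ (subst (λ x → Adj G x q) (sym same) (parent-adj (nonroot dq)) ∷ [ q ])
    distinct : Unique (p ∷ parent p ∷ q ∷ [])
    distinct = (shallower-≢ (≤-reflexive (depth-parent′ dp)) dp ∷ p≢q ∷ [])
             ∷ ((shallower-≢ (≤-reflexive (depth-parent′ dp)) dq ∘ sym) ∷ [])
             ∷ [] ∷ []
    bounded : All (λ x → depth x ≤ suc d) (p ∷ parent p ∷ q ∷ [])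
    bounded = ≤-reflexive dp ∷ ≤-trans (≤-reflexive (depth-parent′ dp)) (n≤1+n d) ∷ ≤-reflexive dq ∷ []
  ... | no differ with bridge d (depth-parent′ dp) (depth-parent′ dq) differ
  ...   | xs , path , distinct , bounded , long =
    (parent p ∷ xs) ∷ʳ q , path′ , distinct′ , bounded′ , s≤s (length-++-≤ʳ (q ∷ []) {xs})
    where
    path′ : Path G p q (p ∷ (parent p ∷ xs) ∷ʳ q)
    path′ = Adj-sym G (parent-adj (nonroot dp)) ∷ Path-∷ʳ G path (parent-adj (nonroot dq))
    distinct′ : Unique (p ∷ (parent p ∷ xs) ∷ʳ q)
    distinct′ = All.∷ʳ⁺ (All.map (λ x≤d → shallower-≢ x≤d dp) bounded) p≢q
              ∷ AllPairs.++⁺ distinct ([] ∷ []) (All.map (λ x≤d → (shallower-≢ x≤d dq ∘ sym) ∷ []) bounded)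
    bounded′ : All (λ x → depth x ≤ suc d) (p ∷ (parent p ∷ xs) ∷ʳ q)
    bounded′ = ≤-reflexive dp ∷ All.∷ʳ⁺ (All.map (λ x≤d → ≤-trans x≤d (n≤1+n d)) bounded) (≤-reflexive dq)

  two-parents : ∀ {a b v} → Adj G a v → Adj G b v → depth a ≡ depth b → depth v ≡ suc (depth a) → a ≡ b
  two-parents {a} {b} {v} av bv da≡db dv with a ≟ b
  ... | yes a≡b = a≡b
  ... | no a≢b with bridge (depth a) refl (sym da≡db) a≢b
  ...   | xs , path , distinct , bounded , long = contradiction cycle acyclic
    where
    cycle : Cycle G
    cycle = v , a ∷ xs , ≤-trans long (n≤1+n _) ,
            All.map (λ x≤ → shallower-≢ x≤ dv) bounded ∷ distinct ,
            Path⇒Consecutive G (Adj-sym G av ∷ Path-∷ʳ G path bv)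

  level-edge-free : ∀ {v w} → Adj G v w → depth v ≢ depth w
  level-edge-free {v} {w} vw dv≡dw with bridge (depth v) refl (sym dv≡dw) (Adj⇒≢ G vw)
  ... | xs , path , distinct , _ , long =
    acyclic (v , xs , long , distinct , Path⇒Consecutive G (Path-∷ʳ G path (Adj-sym G vw)))

  parent-unique : ∀ {p w} → Adj G p w → depth w ≡ suc (depth p) → parent w ≡ p
  parent-unique pw dw = two-parents (parent-adj (nonroot dw)) pw (depth-parent′ dw) (depth-parent (nonroot dw))

  neighbour-cases : ∀ {p w} → Adj G p w → (p ≢ r × w ≡ parent p) ⊎ (w ≢ r × parent w ≡ p)
  neighbour-cases {p} {w} pw with <-cmp (depth p) (depth w)
  ... | tri≈ _ dp≡dw _ = contradiction dp≡dw (level-edge-free pw)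
  ... | tri< dp<dw _ _ = inj₂ (nonroot dw , parent-unique pw dw)
    where
    dw : depth w ≡ suc (depth p)
    dw = ≤-antisym (depth-adj pw) dp<dw
  ... | tri> _ _ dw<dp = inj₁ (nonroot dp , sym (parent-unique (Adj-sym G pw) dp))
    where
    dp : depth p ≡ suc (depth w)
    dp = ≤-antisym (depth-adj (Adj-sym G pw)) dw<dp

  abstract
    deepest-vertex : ∃ λ ℓ → ∀ v → depth v ≤ depth ℓ
    deepest-vertex =
      argmax depth r (allFin n) , λ v → All.lookup (f[xs]≤f[argmax] {f = depth} r (allFin n)) (∈-allFin v)

  depth-induction : (P : Pred (Fin n) 0ℓ) → (∀ v → (∀ {w} → depth w < depth v → P w) → P v) → ∀ v → P v
  depth-induction P extend v = below (suc (depth v)) v ≤-refl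
    where
    below : ∀ k v → depth v < k → P v
    below (suc k) v dv<k = extend v λ dw<dv → below k _ (≤-trans dw<dv (≤-pred dv<k))

  Child : Fin n → Pred (Fin n) 0ℓ
  Child p w = w ≢ r × parent w ≡ p

  child? : ∀ p → Decidable (Child p)
  child? p w = ¬? (w ≟ r) ×-dec (parent w ≟ p)

  child-adj : ∀ {p w} → Child p w → Adj G p w
  child-adj (w≢r , refl) = parent-adj w≢r

  childCount : Fin n → ℕ
  childCount p = count (child? p)

  Thin : Pred (Fin n) 0ℓ
  Thin w = childCount w ≤ 1

  ThinChild : Fin n → Pred (Fin n) 0ℓ
  ThinChild p = Child p ∩ Thin

  thinChild? : ∀ p → Decidable (ThinChild p)
  thinChild? p = child? p ∩? λ w → childCount w ≤? 1

  Good : Pred (Fin n) 0ℓ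
  Good u = count (thinChild? u) ≤ 1

  thin⇒good : ∀ {u} → Thin u → Good u
  thin⇒good thin = ≤-trans (count-mono (thinChild? _) (child? _) proj₁) thin

  designated : Fin n → Maybe (Fin n)
  designated p with any? (thinChild? p)
  ... | yes (w , _) = just w
  ... | no _ with any? (child? p)
  ...   | yes (w , _) = just w
  ...   | no _        = nothing

  Designated : Fin n → Pred (Fin n) 0ℓ
  Designated p u = designated p ≡ just u

  designated-child : ∀ {p u} → Designated p u → Child p u
  designated-child {p} du with any? (thinChild? p)
  ... | yes (w , child , _) = subst (Child p) (just-injective du) child
  ... | no _ with any? (child? p)
  ...   | yes (w , child) = subst (Child p) (just-injective du) child

  designated-exists : ∀ {p w} → Child p w → ∃ (Designated p)
  designated-exists {p} child with any? (thinChild? p)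
  ... | yes (w , _) = w , refl
  ... | no _ with any? (child? p)
  ...   | yes (w , _)    = w , refl
  ...   | no no-children = contradiction (_ , child) no-children

  designated-thin : ∀ {p t u} → ThinChild p t → Designated p u → Thin u
  designated-thin {p} thin-child du with any? (thinChild? p)
  ... | yes (w , _ , thin) = subst Thin (just-injective du) thin
  ... | no no-thin = contradiction (_ , thin-child) no-thin

  Forced : Pred (Fin n) 0ℓ
  Forced u = u ≢ r × Designated (parent u) u × Good u

  forced? : Decidable Forced
  forced? u = ¬? (u ≟ r) ×-dec ≡-dec _≟_ (designated (parent u)) (just u) ×-dec (count (thinChild? u) ≤? 1)

  designated-forced : ∀ {p u} → Designated p u → Good u → Forced u
  designated-forced du good with designated-child du
  ... | u≢r , refl = u≢r , du , good

  forced-designated : ∀ {p w} → Forced w → Child p w → Designated p w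
  forced-designated (_ , dw , _) (_ , refl) = dw

  tfSet : Subset n
  tfSet = toSubset (∁? forced?)

  ∈-tfSet⁺ : ∀ {v} → ¬ Forced v → v ∈ tfSet
  ∈-tfSet⁺ = ∈-toSubset⁺ (∁? forced?)

  ∈-tfSet⁻ : ∀ {v} → v ∈ tfSet → ¬ Forced v
  ∈-tfSet⁻ = ∈-toSubset⁻ (∁? forced?)

  tfSet-isForcingSet : IsForcingSet G tfSet
  tfSet-isForcingSet = depth-induction (Colored G tfSet) colour
    where
    colour : ∀ v → (∀ {w} → depth w < depth v → Colored G tfSet w) → Colored G tfSet v
    colour v shallower with forced? v
    ... | no ¬forced = initial (∈-tfSet⁺ ¬forced)
    ... | yes (v≢r , dv , _) = forced (shallower (parent-shallower v≢r)) (parent-adj v≢r) others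
      where
      others : ∀ w → Adj G (parent v) w → w ≢ v → Colored G tfSet w
      others w pw w≢v with neighbour-cases pw
      ... | inj₁ (p≢r , refl) = shallower (<-trans (parent-shallower p≢r) (parent-shallower v≢r))
      ... | inj₂ child with forced? w
      ...   | no ¬forced = initial (∈-tfSet⁺ ¬forced)
      ...   | yes fw     = contradiction (just-injective (trans (sym (forced-designated fw child)) dv)) w≢v

  root-neighbour-child : ∀ {w} → Adj G r w → Child r w
  root-neighbour-child rw with neighbour-cases rw
  ... | inj₁ (r≢r , _) = contradiction refl r≢r
  ... | inj₂ child     = child

  forced-child-of-thin-parent : ∀ {p t} → ThinChild p t → ∃ λ u → Forced u × parent u ≡ p
  forced-child-of-thin-parent thin-child with designated-exists (proj₁ thin-child)
  ... | u , du = u , designated-forced du (thin⇒good (designated-thin thin-child du)) , proj₂ (designated-child du)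

  unforced-child : ∀ {x} → 2 ≤ childCount x → ∃ λ y → Child x y × ¬ Forced y
  unforced-child {x} 2≤ with count-witness (child? x) (≤-trans (s≤s z≤n) 2≤)
  ... | c , child with designated-exists child
  ...   | z , dz with 2≤count⇒other (child? x) z 2≤
  ...     | y , child-y , y≢z =
    y , child-y , λ fy → y≢z (just-injective (trans (sym (forced-designated fy child-y)) dz))

  -- An unforced vertex below a good vertex cannot be thin: either it is the designated child, and then
  -- it is not good, or a thin sibling would have been designated in its place.
  branching : ∀ {v} → v ≢ r → ¬ Forced v → Good (parent v) → 2 ≤ childCount v
  branching {v} v≢r ¬fv good-p with designated-exists (v≢r , refl)
  ... | z , dz with z ≟ v
  ...   | yes refl = ≤-trans (≰⇒> λ good-v → ¬fv (designated-forced dz good-v))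
                             (count-mono (thinChild? v) (child? v) proj₁)
  ...   | no z≢v = ≰⇒> λ thin-v →
    let thin-z = designated-thin ((v≢r , refl) , thin-v) dz
    in <⇒≱ (2≤count (thinChild? _) ((v≢r , refl) , thin-v) (designated-child dz , thin-z) (z≢v ∘ sym)) good-p

  tfSet-noIsolated : ∀ {a b} → Adj G r a → Adj G r b → a ≢ b → NoIsolatedIn G tfSet
  tfSet-noIsolated {a} {b} ra rb a≢b v v∈S with v ≟ r
  ... | yes refl with forced? a
  ...   | no ¬fa = a , ∈-tfSet⁺ ¬fa , ra
  ...   | yes fa = b , ∈-tfSet⁺ ¬fb , rb
    where
    ¬fb : ¬ Forced b
    ¬fb fb = a≢b (just-injective (trans (sym (forced-designated fa (root-neighbour-child ra)))
                                        (forced-designated fb (root-neighbour-child rb))))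
  tfSet-noIsolated ra rb a≢b v v∈S | no v≢r with forced? (parent v)
  ... | no ¬fp = parent v , ∈-tfSet⁺ ¬fp , Adj-sym G (parent-adj v≢r)
  ... | yes (_ , _ , good-p) with unforced-child (branching v≢r (∈-tfSet⁻ v∈S) good-p)
  ...   | y , child , ¬fy = y , ∈-tfSet⁺ ¬fy , child-adj child

  tfSet-isTFSet : ∀ {a b} → Adj G r a → Adj G r b → a ≢ b → IsTFSet G tfSet
  tfSet-isTFSet ra rb a≢b = tfSet-isForcingSet , tfSet-noIsolated ra rb a≢b

  Zone : Fin n → Pred (Fin n) 0ℓ
  Zone u x = x ≡ parent u ⊎ (parent u ≢ r × x ≡ parent (parent u)) ⊎ (Child (parent u) x × childCount x ≡ 0)

  zone? : ∀ u → Decidable (Zone u)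
  zone? u x = x ≟ parent u
         ⊎-dec (¬? (parent u ≟ r) ×-dec x ≟ parent (parent u))
         ⊎-dec (child? (parent u) x ×-dec childCount x ℕ.≟ 0)

  zone⊆closedNbhd : ∀ u {x} → Zone u x → x ≡ parent u ⊎ Adj G (parent u) x
  zone⊆closedNbhd u (inj₁ x≡p)                  = inj₁ x≡p
  zone⊆closedNbhd u (inj₂ (inj₁ (p≢r , refl))) = inj₂ (Adj-sym G (parent-adj p≢r))
  zone⊆closedNbhd u (inj₂ (inj₂ (child , _)))  = inj₂ (child-adj child)

  count-zone : ∀ u → count (zone? u) ≤ suc (degree G (parent u))
  count-zone u = ≤-trans (count-mono (zone? u) (closedNbhd? G (parent u)) (zone⊆closedNbhd u))
                         (count-closedNbhd G (parent u))

  module _ {a} (ra : Adj G r a) where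

    leaf⇒nonroot : ∀ {x} → childCount x ≡ 0 → x ≢ r
    leaf⇒nonroot leaf refl = contradiction leaf (m<n⇒n≢0 (1≤count (child? r) (root-neighbour-child ra)))

    zones-cover : ∀ x → ∃ λ u → Forced u × Zone u x
    zones-cover x with childCount x ℕ.≟ 0
    ... | yes leaf with forced-child-of-thin-parent ((leaf⇒nonroot leaf , refl) , ≤-trans (≤-reflexive leaf) z≤n)
    ...   | u , forced-u , pu≡px = u , forced-u , inj₂ (inj₂ ((leaf⇒nonroot leaf , sym pu≡px) , leaf))
    zones-cover x | no has-child with count-witness (child? x) (n≢0⇒n>0 has-child)
    ...   | _ , child with designated-exists child
    ...     | c , dc with count (thinChild? c) ≤? 1
    ...       | yes good-c = c , designated-forced dc good-c , inj₁ (sym (proj₂ (designated-child dc)))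
    ...       | no ¬good-c with count-witness (thinChild? c) (≤-trans (s≤s z≤n) (≰⇒> ¬good-c))
    ...         | _ , thin-child with forced-child-of-thin-parent thin-child
    ...           | u , forced-u , refl =
      u , forced-u , inj₂ (inj₁ (proj₁ (designated-child dc) , sym (proj₂ (designated-child dc))))

  first-forced : ∀ {ℓ} → Adj G r ℓ → (∀ {w} → Adj G ℓ w → w ≡ r) →
                 ∃ λ u → Forced u × parent u ≡ r
  first-forced {ℓ} rℓ ℓ-leaf = forced-child-of-thin-parent (root-neighbour-child rℓ , thin-ℓ)
    where
    thin-ℓ : Thin ℓ
    thin-ℓ = ≤-trans (≤-reflexive (count-empty (child? ℓ) λ w child → proj₁ child (ℓ-leaf (child-adj child)))) z≤n

  count-zone-< : ∀ {u z} → parent u ≡ r → Adj G r z → childCount z ≢ 0 → count (zone? u) < suc (degree G r)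
  count-zone-< {u} {z} pu≡r rz has-child =
    ≤-trans (count-mono-< (zone? u) (closedNbhd? G r) (subst (λ p → _ ≡ p ⊎ Adj G p _) pu≡r ∘ zone⊆closedNbhd u)
                          (inj₂ rz) z∉zone)
            (count-closedNbhd G r)
    where
    z∉zone : ¬ Zone u z
    z∉zone (inj₁ z≡pu)               = Adj⇒≢ G rz (sym (trans z≡pu pu≡r))
    z∉zone (inj₂ (inj₁ (pu≢r , _))) = pu≢r pu≡r
    z∉zone (inj₂ (inj₂ (_ , leaf)))  = has-child leaf

  depth-root-neighbour : ∀ {v} → Adj G r v → depth v ≡ 1
  depth-root-neighbour rv with root-neighbour-child rv
  ... | v≢r , pv≡r = trans (depth-parent v≢r) (cong suc (trans (cong depth pv≡r) depth-root))

  root-neighbours-independent : ∀ {v w} → Adj G r v → Adj G r w → ¬ Adj G v w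
  root-neighbours-independent rv rw vw = level-edge-free vw (trans (depth-root-neighbour rv) (sym (depth-root-neighbour rw)))

  leaf-neighbours⇒star : (∀ {z} → Adj G r z → childCount z ≡ 0) → ∀ v → v ≡ r ⊎ Adj G r v
  leaf-neighbours⇒star leaves = depth-induction _ star
    where
    star : ∀ v → (∀ {w} → depth w < depth v → w ≡ r ⊎ Adj G r w) → v ≡ r ⊎ Adj G r v
    star v shallower with v ≟ r
    ... | yes v≡r = inj₁ v≡r
    ... | no v≢r with shallower (parent-shallower v≢r)
    ...   | inj₁ pv≡r = inj₂ (subst (λ p → Adj G p v) pv≡r (parent-adj v≢r))
    ...   | inj₂ r-pv = contradiction (leaves r-pv) (m<n⇒n≢0 (1≤count (child? (parent v)) (v≢r , refl)))

  grandchild-or-star : (∃ λ z → Adj G r z × childCount z ≢ 0) ⊎ G ≅ Star (maxDegree G)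
  grandchild-or-star with any? (λ z → adj? G r z ×-dec ¬? (childCount z ℕ.≟ 0))
  ... | yes grandparent = inj₁ grandparent
  ... | no none = inj₂ (StarShaped.star-≅ G r spoke root-neighbours-independent)
    where
    leaves : ∀ {z} → Adj G r z → childCount z ≡ 0
    leaves {z} rz = decidable-stable (childCount z ℕ.≟ 0) λ has-child → none (z , rz , has-child)
    spoke : ∀ {v} → v ≢ r → Adj G r v
    spoke {v} v≢r = Sum.[ (λ v≡r → contradiction v≡r v≢r) , id ] (leaf-neighbours⇒star leaves v)

outside-pair : 3 ≤ n → (a b : Fin n) → ∃ λ z → z ≢ a × z ≢ b
outside-pair {n} 3≤n a b with any? (∁? ((_≟ a) ∪? (_≟ b)))
... | yes (z , z∉) = z , z∉ ∘ inj₁ , z∉ ∘ inj₂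
... | no none = contradiction (begin
    n                               ≡⟨ count-complement pair? ⟨
    count pair? + count (∁? pair?)  ≡⟨ cong (count pair? +_) (count-empty (∁? pair?) λ x x∉ → none (x , x∉)) ⟩
    count pair? + 0                 ≡⟨ +-identityʳ _ ⟩
    count pair?                     ≤⟨ count-∪ (_≟ a) (_≟ b) ⟩
    count (_≟ a) + count (_≟ b)     ≡⟨ cong₂ _+_ (count-≡ a) (count-≡ b) ⟩
    2                               ∎) (<⇒≱ 3≤n)
  where
  open ≤-Reasoning
  pair? : Decidable (λ x → x ≡ a ⊎ x ≡ b)
  pair? = (_≟ a) ∪? (_≟ b)

record RootedAtLeaf {n} (G : Graph n) : Set where
  field
    root leaf other : Fin n
    root-leaf       : Adj G root leaf
    root-other      : Adj G root other
    leaf≢other      : leaf ≢ other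
    leaf-only       : ∀ {w} → Adj G leaf w → w ≡ root

-- The parent of a deepest vertex works: the deepest vertex is a leaf, and
-- the tree has a third vertex, which must be reached through the root.
rootedAtLeaf : ∀ {n} (G : Graph n) → Connected G → Acyclic G → 3 ≤ n → RootedAtLeaf G
rootedAtLeaf {suc n} G connected acyclic 3≤n with RootedTree.deepest-vertex G connected acyclic zero
... | ℓ , deepest = record
  { root = parent ℓ ; leaf = ℓ ; other = proj₁ other ; root-leaf = parent-adj ℓ≢zero
  ; root-other = proj₁ (proj₂ other) ; leaf≢other = proj₂ (proj₂ other) ; leaf-only = ℓ-only }
  where
  open RootedTree G connected acyclic zero
  ℓ≢zero : ℓ ≢ zero
  ℓ≢zero ℓ≡zero with outside-pair 3≤n zero zero
  ... | z , z≢zero , _ =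
    z≢zero (depth≡0⇒root (n≤0⇒n≡0 (≤-trans (deepest z) (≤-reflexive (trans (cong depth ℓ≡zero) depth-root)))))
  ℓ-only : ∀ {w} → Adj G ℓ w → w ≡ parent ℓ
  ℓ-only ℓw with neighbour-cases ℓw
  ... | inj₁ (_ , w≡pℓ)     = w≡pℓ
  ... | inj₂ (w≢zero , refl) = contradiction (deepest _) (<⇒≱ (parent-shallower w≢zero))
  other : ∃ λ c → Adj G (parent ℓ) c × ℓ ≢ c
  other with any? (λ c → adj? G (parent ℓ) c ×-dec ¬? (ℓ ≟ c))
  ... | yes (c , spec) = c , spec
  ... | no none with outside-pair 3≤n (parent ℓ) ℓ
  ...   | z , z≢r , z≢ℓ = ⊥-elim (Sum.[ z≢r , z≢ℓ ] (walk-closed G step-within (connected ℓ z) (inj₂ refl)))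
    where
    step-within : ∀ {u v} → Adj G u v → u ≡ parent ℓ ⊎ u ≡ ℓ → v ≡ parent ℓ ⊎ v ≡ ℓ
    step-within uv (inj₁ refl) = inj₂ (sym (decidable-stable (ℓ ≟ _) λ ℓ≢v → none (_ , uv , ℓ≢v)))
    step-within uv (inj₂ refl) = inj₁ (ℓ-only uv)

-- Total forcing sets of stars

colored-seed : ∀ {n} {G : Graph n} {S v} → Colored G S v → ∃ (_∈ S)
colored-seed (initial v∈S)  = _ , v∈S
colored-seed (forced cu _ _) = colored-seed cu

module Centred {n} (G : Graph n) (c : Fin n) (through-c : ∀ {u v} → Adj G u v → u ≡ c ⊎ v ≡ c)
               (spoke : ∀ {v} → v ≢ c → Adj G c v) {S : Subset n} (tf : IsTFSet G S) where

  -- With the centre coloured, a vertex outside S can only be forced by the centre, which needs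
  -- every other vertex outside S to be coloured first; with the centre uncoloured, S has no edges.
  outside-unique : ∀ {a b} → a ∉ S → b ∉ S → a ≡ b
  outside-unique {a} {b} a∉S b∉S with a ≟ b | c ∈? S
  ... | yes a≡b | _ = a≡b
  ... | no a≢b | yes c∈S = contradiction (inj₁ refl) (never-coloured (proj₁ tf a))
    where
    excluded : ∀ {x} → x ≡ a ⊎ x ≡ b → x ∉ S
    excluded (inj₁ refl) = a∉S
    excluded (inj₂ refl) = b∉S
    partner : ∀ {x} → x ≡ a ⊎ x ≡ b → ∃ λ y → (y ≡ a ⊎ y ≡ b) × y ≢ x
    partner (inj₁ refl) = b , inj₂ refl , a≢b ∘ sym
    partner (inj₂ refl) = a , inj₁ refl , a≢b
    never-coloured : ∀ {x} → Colored G S x → ¬ (x ≡ a ⊎ x ≡ b)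
    never-coloured (initial x∈S) x∈ab = excluded x∈ab x∈S
    never-coloured (forced {u} cu ux others) x∈ab with through-c ux | partner x∈ab
    ... | inj₂ refl | _ = excluded x∈ab c∈S
    ... | inj₁ refl | y , y∈ab , y≢x =
      never-coloured (others y (spoke λ { refl → excluded y∈ab c∈S }) y≢x) y∈ab
  ... | no _ | no c∉S with colored-seed (proj₁ tf a)
  ...   | s , s∈S with proj₂ tf s s∈S
  ...     | u , u∈S , su with through-c su
  ...       | inj₁ refl = contradiction s∈S c∉S
  ...       | inj₂ refl = contradiction u∈S c∉S

  n≤1+∣S∣ : n ≤ suc ∣ S ∣
  n≤1+∣S∣ = begin
    n                                   ≡⟨ count-complement (_∈? S) ⟨
    count (_∈? S) + count (∁? (_∈? S))  ≤⟨ +-monoʳ-≤ (count (_∈? S)) (count≤1 (∁? (_∈? S)) outside-unique) ⟩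
    count (_∈? S) + 1                   ≡⟨ +-comm _ 1 ⟩
    suc (count (_∈? S))                 ≡⟨ cong suc (∣∣≡count S) ⟨
    suc ∣ S ∣                           ∎
    where open ≤-Reasoning

module FromStar {n m} {G : Graph n} (iso : G ≅ Star m) where
  open _≅_ iso
  open Inverse bij

  centre : Fin n
  centre = from zero

  n≡1+m : n ≡ suc m
  n≡1+m = Perm.↔⇒≡ bij

  private
    isZero-centre : ∀ {u} → isZero (to u) ≡ true → u ≡ centre
    isZero-centre {u} isZ with to u in eq
    ... | zero = trans (sym (strictlyInverseʳ u)) (cong from eq)

  through-centre : ∀ {u v} → Adj G u v → u ≡ centre ⊎ v ≡ centre
  through-centre {u} {v} uv with isZero (to u) in eu | isZero (to v) in ev
  ... | true  | _     = inj₁ (isZero-centre eu)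
  ... | false | true  = inj₂ (isZero-centre ev)
  ... | false | false = ⊥-elim (subst T (trans (preserve u v) (cong₂ _xor_ eu ev)) uv)

  spoke : ∀ {v} → v ≢ centre → Adj G centre v
  spoke {v} v≢c with isZero (to v) in ev
  ... | true  = contradiction (isZero-centre ev) v≢c
  ... | false = subst T (sym (trans (preserve centre v) (cong₂ _xor_ (cong isZero (strictlyInverseˡ zero)) ev))) _

tfSet-of-star : ∀ {n m} {G : Graph n} → G ≅ Star m → ∀ {S} → IsTFSet G S → m ≤ ∣ S ∣
tfSet-of-star {G = G} iso {S} tf =
  ≤-pred (subst (_≤ suc ∣ S ∣) n≡1+m (Centred.n≤1+∣S∣ G centre through-centre spoke tf))
  where open FromStar iso

-- The bound

tf-arithmetic : ∀ {k s m N D} e → k ≤ s → s + m ≡ N → e + N ≤ suc D * m → e + k * (D + 1) ≤ D * N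
tf-arithmetic {k} {s} {m} {N} {D} e k≤s s+m≡N bound = begin
  e + k * (D + 1)  ≤⟨ +-monoʳ-≤ e (*-monoˡ-≤ (D + 1) k≤s) ⟩
  e + s * (D + 1)  ≡⟨ regroup e s D ⟩
  D * s + (s + e)  ≤⟨ +-monoʳ-≤ (D * s) s+e≤Dm ⟩
  D * s + D * m    ≡⟨ *-distribˡ-+ D s m ⟨
  D * (s + m)      ≡⟨ cong (D *_) s+m≡N ⟩
  D * N            ∎
  where
  open ≤-Reasoning
  regroup : ∀ e s D → e + s * (D + 1) ≡ D * s + (s + e)
  regroup = solve-∀
  regroup′ : ∀ s e m → s + e + m ≡ e + (s + m)
  regroup′ = solve-∀
  s+e≤Dm : s + e ≤ D * m
  s+e≤Dm = +-cancelʳ-≤ m (s + e) (D * m) (begin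
    s + e + m      ≡⟨ regroup′ s e m ⟩
    e + (s + m)    ≡⟨ cong (e +_) s+m≡N ⟩
    e + N          ≤⟨ bound ⟩
    suc D * m      ≡⟨ +-comm m (D * m) ⟩
    D * m + m      ∎)

theorem2 : (n : ℕ) (T : Graph n) → IsTree T → 3 ≤ n →
    (k : ℕ) → IsTotalForcingNumber T k →
    (k * (maxDegree T + 1) ≤ maxDegree T * n) ×
    ((k * (maxDegree T + 1) ≡ maxDegree T * n) ⇔ (T ≅ Star (maxDegree T)))
theorem2 n T (connected , acyclic) 3≤n k ((S₀ , tf₀ , ∣S₀∣≡k) , k-least) = upper , mk⇔ equality⇒star star⇒equality
  where
  open RootedAtLeaf (rootedAtLeaf T connected acyclic 3≤n)
  open RootedTree T connected acyclic root
  open DoubleCounting forced? zone? (zones-cover root-leaf)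

  Δ : ℕ
  Δ = maxDegree T

  k≤∣tfSet∣ : k ≤ count (∁? forced?)
  k≤∣tfSet∣ = ≤-trans (k-least tfSet (tfSet-isTFSet root-leaf root-other leaf≢other))
                      (≤-reflexive (∣toSubset∣ (∁? forced?)))

  split : count (∁? forced?) + count forced? ≡ n
  split = trans (+-comm _ (count forced?)) (count-complement forced?)

  zone≤1+Δ : ∀ {u} → Forced u → count (zone? u) ≤ suc Δ
  zone≤1+Δ {u} _ = ≤-trans (count-zone u) (s≤s (degree≤maxDegree T (parent u)))

  upper : k * (Δ + 1) ≤ Δ * n
  upper = tf-arithmetic 0 k≤∣tfSet∣ split (covering-bound zone≤1+Δ)

  equality⇒star : k * (Δ + 1) ≡ Δ * n → T ≅ Star Δ
  equality⇒star eq with grandchild-or-star | first-forced root-leaf leaf-only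
  ... | inj₂ star                 | _                       = star
  ... | inj₁ (z , rz , has-child) | u₀ , forced-u₀ , pu₀≡r = contradiction eq (<⇒≢ strict)
    where
    strict : 1 + k * (Δ + 1) ≤ Δ * n
    strict = tf-arithmetic 1 k≤∣tfSet∣ split (covering-bound-< zone≤1+Δ forced-u₀
               (≤-trans (count-zone-< pu₀≡r rz has-child) (s≤s (degree≤maxDegree T root))))

  star⇒equality : T ≅ Star Δ → k * (Δ + 1) ≡ Δ * n
  star⇒equality iso = cong₂ _*_ k≡Δ (trans (+-comm Δ 1) (sym n≡1+Δ))
    where
    n≡1+Δ : n ≡ suc Δ
    n≡1+Δ = FromStar.n≡1+m iso
    k≤Δ : k ≤ Δ
    k≤Δ = *-cancelʳ-≤ k Δ (suc Δ) (subst₂ (λ a b → k * a ≤ Δ * b) (+-comm Δ 1) n≡1+Δ upper)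
    k≡Δ : k ≡ Δ
    k≡Δ = ≤-antisym k≤Δ (subst (Δ ≤_) ∣S₀∣≡k (tfSet-of-star iso tf₀))
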